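{- Run Algorithm T (as described in the context) on a finite directed graph to completion. The set of low arcs of the followers forms a forest of in-trees whose roots are the leaders of the strong components.
   Context: Loops and parallel arcs are allowed. Two vertices are mutually reachable if each is reachable from the other; the equivalence classes are the strong components. A depth-first exploration proceeds as follows. Initially all vertices are unvisited, all arcs untraversed, and the current vertex is null. Repeat the applicable case until all vertices are visited and all arcs are traversed: (i) The current vertex is null and some vertex is unvisited: choose any unvisited $v$, make it current and visit it; $v$ is a root. (ii) The current vertex $v$ has an untraversed exiting arc: choose any such arc $a$, from $v$ to $w$, and advance on it. If $w$ is visited, immediately retreat on $a$. Otherwise $a$ becomes a tree arc, $w$ becomes current and is visited. (iii) The current vertex $v$ has no untraversed exiting arc: if $v$ is a root, the current vertex becomes null; otherwise retreat on the tree arc entering $v$, from $u$ say, and make $u$ current. The first visit of $v$ is its previsit. The step (iii) at which $v$ is current with no untraversed exiting arc is its postvisit. Algorithm T does one depth-first exploration with a stack $F$ (initially empty): - Previsit of $v$: set $v.\mathit{pre}$ to the next integer $1,2,\dots$ and $v.\mathit{low}\gets v.\mathit{pre}$. - Retreat on any arc from $v$ to $w$: set $v.\mathit{low}\gets\min\{v.\mathit{low},w.\mathit{low}\}$. - Postvisit of $v$: - If $v.\mathit{low}\ne v.\mathit{pre}$, push $v$ on $F$. - Otherwise, pop from $F$ every top vertex $x$ with $x.\mathit{low}\ge v.\mathit{low}$, until $F$ is empty or its top has smaller low; set each popped $x.\mathit{low}\gets\infty$. Then set $v.\mathit{low}\gets\infty$. The leader of a strong component is its vertex of minimum $\mathit{pre}$;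 the other vertices are followers. For each follower $v$, its low arc is the arc exiting $v$ whose retreat caused the most recent decrease of $v.\mathit{low}$. An in-tree is a set of arcs, one out of each vertex except one (the root), forming no cycle. -}

module Defs where

open import Data.Nat using (ℕ; zero; suc; _≤_; _<ᵇ_; _≡ᵇ_)
open import Data.Fin using (Fin; _≟_)
open import Data.Bool using (Bool; true; false; if_then_else_; not)
open import Data.Maybe using (Maybe; just; nothing)
open import Data.List using (List; []; _∷_)
open import Data.Product using (Σ; _×_; _,_; proj₁; proj₂)
open import Relation.Nullary using (¬_; yes; no)
open import Relation.Binary.PropositionalEquality using (_≡_; _≢_)
open import Relation.Binary.Construct.Closure.ReflexiveTransitive using (Star)

record Digraph (n m : ℕ) : Set where
  field
    src : Fin m → Fin n
    tgt : Fin m → Fin n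

data ℕ∞ : Set where
  fin : ℕ → ℕ∞
  ∞   : ℕ∞

_<∞ᵇ_ : ℕ∞ → ℕ∞ → Bool
fin a <∞ᵇ fin b = a <ᵇ b
fin _ <∞ᵇ ∞     = true
∞     <∞ᵇ _     = false

_≡∞ᵇ_ : ℕ∞ → ℕ∞ → Bool
fin a ≡∞ᵇ fin b = a ≡ᵇ b
∞     ≡∞ᵇ ∞     = true
_     ≡∞ᵇ _     = false

upd : ∀ {k} {A : Set} → (Fin k → A) → Fin k → A → Fin k → A
upd f v x w with w ≟ v
... | yes _ = x
... | no  _ = f w

module Run {n m : ℕ} (G : Digraph n m) where
  open Digraph G

  -- State of Algorithm T during the depth-first exploration.
  -- pre v = 0 means v is unvisited; cur = nothing means current vertex is null;
  -- parent v = tree arc entering v (nothing for roots / unvisited);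
  -- lowArc v = arc whose retreat caused the most recent decrease of v.low.
  record State : Set where
    field
      pre    : Fin n → ℕ
      low    : Fin n → ℕ∞
      next   : ℕ
      trav   : Fin m → Bool
      cur    : Maybe (Fin n)
      parent : Fin n → Maybe (Fin m)
      stack  : List (Fin n)
      lowArc : Fin n → Maybe (Fin m)
  open State public

  init : State
  init = record
    { pre = λ _ → 0 ; low = λ _ → ∞ ; next = 1 ; trav = λ _ → false
    ; cur = nothing ; parent = λ _ → nothing ; stack = [] ; lowArc = λ _ → nothing }

  previsit : State → Fin n → State
  previsit s v = record s
    { pre = upd (pre s) v (next s) ; low = upd (low s) v (fin (next s))
    ; next = suc (next s) ; cur = just v }

  markTrav : State → Fin m → State
  markTrav s a = record s { trav = upd (trav s) a true }

  retreat : State → Fin m → State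
  retreat s a =
    if low s (tgt a) <∞ᵇ low s (src a)
    then record s { low = upd (low s) (src a) (low s (tgt a))
                  ; lowArc = upd (lowArc s) (src a) (just a) }
    else s

  popF : (Fin n → ℕ∞) → ℕ∞ → List (Fin n) → (Fin n → ℕ∞) × List (Fin n)
  popF l t [] = l , []
  popF l t (x ∷ xs) =
    if l x <∞ᵇ t then (l , x ∷ xs) else popF (upd l x ∞) t xs

  postvisit : State → Fin n → State
  postvisit s v =
    if not (low s v ≡∞ᵇ fin (pre s v))
    then record s { stack = v ∷ stack s }
    else record s { low = upd (proj₁ r) v ∞ ; stack = proj₂ r }
    where r = popF (low s) (low s v) (stack s)

  data Step : State → State → Set where
    start : ∀ s v → cur s ≡ nothing → pre s v ≡ 0 →
            Step s (record (previsit s v) { parent = upd (parent s) v nothing })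
    -- case (ii), target already visited: advance and immediately retreat
    advVisited : ∀ s v a → cur s ≡ just v → src a ≡ v → trav s a ≡ false →
                 pre s (tgt a) ≢ 0 → Step s (retreat (markTrav s a) a)
    advTree : ∀ s v a → cur s ≡ just v → src a ≡ v → trav s a ≡ false →
              pre s (tgt a) ≡ 0 →
              Step s (record (previsit (markTrav s a) (tgt a))
                             { parent = upd (parent s) (tgt a) (just a) })
    postRoot : ∀ s v → cur s ≡ just v → (∀ a → src a ≡ v → trav s a ≡ true) →
               parent s v ≡ nothing → Step s (record (postvisit s v) { cur = nothing })
    postTree : ∀ s v a → cur s ≡ just v → (∀ b → src b ≡ v → trav s b ≡ true) →
               parent s v ≡ just a →
               Step s (retreat (record (postvisit s v) { cur = just (src a) }) a)

  Reachable : State → Set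
  Reachable s = Star Step init s

  Final : State → Set
  Final s = (cur s ≡ nothing) × (∀ v → pre s v ≢ 0) × (∀ a → trav s a ≡ true)

  data Reach : Fin n → Fin n → Set where
    here : ∀ {v} → Reach v v
    step : ∀ {u w} a → src a ≡ u → Reach (tgt a) w → Reach u w

  MutuallyReachable : Fin n → Fin n → Set
  MutuallyReachable u v = Reach u v × Reach v u

  Leader : State → Fin n → Set
  Leader s v = ∀ w → MutuallyReachable v w → pre s v ≤ pre s w

  Follower : State → Fin n → Set
  Follower s v = ¬ Leader s v

  LowArcs : State → Fin m → Set
  LowArcs s a = Σ (Fin n) λ v → Follower s v × lowArc s v ≡ just a

  data Walk (S : Fin m → Set) : Fin n → Fin n → Set where
    nil  : ∀ {v} → Walk S v v
    cons : ∀ {u w} a → S a → src a ≡ u → Walk S (tgt a) w → Walk S u w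

  HasCycle : (Fin m → Set) → Set
  HasCycle S = Σ (Fin n) λ v → Σ (Fin m) λ a → S a × src a ≡ v × Walk S (tgt a) v

  IsInForest : (Fin m → Set) → (Fin n → Set) → Set
  IsInForest S Root =
    (∀ v → ¬ Root v → Σ (Fin m) λ a → S a × src a ≡ v × (∀ b → S b → src b ≡ v → b ≡ a))
    × (∀ v → Root v → ∀ a → S a → src a ≢ v)
    × ¬ HasCycle S

{-# OPTIONS --safe #-}
module Submission where

-- Acyclicity comes from two ghost variables: L v, the last finite value of v.low, and
-- Tm v, the time of the last decrease of v.low.  Retreating on the low arc a of v copies
-- the low of tgt a into v with a fresh time stamp, and lows only decrease afterwards, so
-- (L, Tm) strictly decreases lexicographically along every low arc.
--
-- A vertex v without low arc keeps v.low = v.pre, so its postvisit pops.  At that moment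
-- every vertex reachable from v with finite low was pushed after v, and a vertex with
-- low = ∞ belongs to a completed component, whose out-neighbours are all completed too,
-- so it cannot reach v.  Hence the strong component of v lies among the vertices popped
-- with v, all with larger pre: v is a leader.  Followers therefore have low arcs, and
-- by definition leaders contribute none.

open import Data.Nat using (ℕ; suc; _≤_; _<_; _<ᵇ_; z≤n; s≤s; _<?_)
open import Data.Nat.Properties hiding (_≟_)
open import Data.Fin using (Fin; _≟_)
open import Data.Bool using (Bool; true; false; T)
open import Data.Maybe using (Maybe; just; nothing)
open import Data.Maybe.Properties using (just-injective)
open import Data.List using (List; []; _∷_; _++_; head)
open import Data.List.Relation.Unary.All as All using (All; []; _∷_)
open import Data.List.Relation.Unary.Any using (here; there)
open import Data.List.Membership.Propositional using (_∈_; _∉_)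
open import Data.List.Membership.Propositional.Properties using (∈-++⁻; ∈-++⁺ˡ; ∈-++⁺ʳ)
open import Data.Product using (Σ; _×_; _,_; proj₁; proj₂)
open import Data.Product.Relation.Binary.Lex.Strict using (×-Lex; ×-transitive; ×-irreflexive)
open import Data.Sum using (_⊎_; inj₁; inj₂)
open import Data.Empty using (⊥; ⊥-elim)
open import Data.Unit using (⊤; tt)
open import Relation.Nullary using (¬_; Dec; yes; no)
open import Relation.Binary.PropositionalEquality
open import Relation.Binary.Construct.Closure.ReflexiveTransitive using (Star; ε; _◅_)
open import Defs

upd-≡ : ∀ {k} {A : Set} (f : Fin k → A) v x → upd f v x v ≡ x
upd-≡ f v x with v ≟ v
... | yes _ = refl
... | no v≢v = ⊥-elim (v≢v refl)

upd-≢ : ∀ {k} {A : Set} (f : Fin k → A) v x w → w ≢ v → upd f v x w ≡ f w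
upd-≢ f v x w w≢v with w ≟ v
... | yes w≡v = ⊥-elim (w≢v w≡v)
... | no _ = refl

nothing≢just : ∀ {A : Set} {x : A} → nothing ≢ just x
nothing≢just ()

fin≢∞ : ∀ {k} → fin k ≢ ∞
fin≢∞ ()

fin-injective : ∀ {a b} → fin a ≡ fin b → a ≡ b
fin-injective refl = refl

IsFin : ℕ∞ → Set
IsFin x = Σ ℕ λ k → x ≡ fin k

data _≤∞_ : ℕ∞ → ℕ∞ → Set where
  fin≤fin : ∀ {a b} → a ≤ b → fin a ≤∞ fin b
  _≤∞∞ : ∀ x → x ≤∞ ∞

≤∞-refl : ∀ x → x ≤∞ x
≤∞-refl (fin a) = fin≤fin ≤-refl
≤∞-refl ∞ = ∞ ≤∞∞

≤∞-trans : ∀ {x y z} → x ≤∞ y → y ≤∞ z → x ≤∞ z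
≤∞-trans (fin≤fin p) (fin≤fin q) = fin≤fin (≤-trans p q)
≤∞-trans _ (_ ≤∞∞) = _ ≤∞∞

<∞ᵇ-true⇒< : ∀ x y → (x <∞ᵇ y) ≡ true → Σ ℕ λ a → x ≡ fin a × (∀ b → y ≡ fin b → a < b)
<∞ᵇ-true⇒< (fin a) (fin b) e = a , refl , λ { b refl → <ᵇ⇒< a b (subst T (sym e) tt) }
<∞ᵇ-true⇒< (fin a) ∞ e = a , refl , λ _ ()

<∞ᵇ-false⇒≥∞ : ∀ x y → (x <∞ᵇ y) ≡ false → y ≤∞ x
<∞ᵇ-false⇒≥∞ (fin a) (fin b) e = fin≤fin (≮⇒≥ (λ a<b → subst T e (<⇒<ᵇ a<b)))
<∞ᵇ-false⇒≥∞ ∞ y e = y ≤∞∞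

<⇒<∞ᵇ : ∀ a b → a < b → (fin a <∞ᵇ fin b) ≡ true
<⇒<∞ᵇ a b a<b with a <ᵇ b | <⇒<ᵇ {a} {b} a<b
... | true | _ = refl

≤∞⇒≮∞ᵇ : ∀ x y → x ≤∞ y → (y <∞ᵇ x) ≡ false
≤∞⇒≮∞ᵇ (fin a) (fin b) (fin≤fin a≤b) with b <ᵇ a in eq
... | false = refl
... | true = ⊥-elim (<⇒≱ (<ᵇ⇒< b a (subst T (sym eq) tt)) a≤b)
≤∞⇒≮∞ᵇ x ∞ (_ ≤∞∞) = refl

≡∞ᵇ-true⇒≡ : ∀ x y → (x ≡∞ᵇ y) ≡ true → x ≡ y
≡∞ᵇ-true⇒≡ (fin a) (fin b) e = cong fin (≡ᵇ⇒≡ a b (subst T (sym e) tt))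
≡∞ᵇ-true⇒≡ ∞ ∞ e = refl

≡∞ᵇ-false⇒≢ : ∀ x y → (x ≡∞ᵇ y) ≡ false → x ≢ y
≡∞ᵇ-false⇒≢ (fin a) (fin a) e refl = subst T e (≡⇒≡ᵇ a a refl)

_<ₗₑₓ_ : ℕ × ℕ → ℕ × ℕ → Set
_<ₗₑₓ_ = ×-Lex _≡_ _<_ _<_

<ₗₑₓ-trans : ∀ {p q r} → p <ₗₑₓ q → q <ₗₑₓ r → p <ₗₑₓ r
<ₗₑₓ-trans = ×-transitive {_<₂_ = _<_} isEquivalence (resp₂ _<_) <-trans <-trans

<ₗₑₓ-irrefl : ∀ {p} → ¬ p <ₗₑₓ p
<ₗₑₓ-irrefl = ×-irreflexive {_<₁_ = _<_} {_<₂_ = _<_} <-irrefl <-irrefl (refl , refl)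

All-map∈ : ∀ {k} {P Q : Fin k → Set} {xs} → (∀ x → x ∈ xs → P x → Q x) → All P xs → All Q xs
All-map∈ f ps = All.tabulate λ i → f _ i (All.lookup ps i)

head≡nothing⇒[] : ∀ {A : Set} (xs : List A) → head xs ≡ nothing → xs ≡ []
head≡nothing⇒[] [] _ = refl
head≡nothing⇒[] (_ ∷ _) ()

-- Unlike `x ≟ y`, the term `x ≡? y` does not occur in `upd f y a x`, so a `with` on it
-- leaves such goals unabstracted.
_≡?_ : ∀ {k} (x y : Fin k) → Dec (x ≡ y)
x ≡? y with y ≟ x
... | yes y≡x = yes (sym y≡x)
... | no y≢x = no (λ x≡y → y≢x (sym x≡y))


module Invariants {n m : ℕ} (G : Digraph n m) where
  open Digraph G
  open Run G

  data SplitsAt (p : Fin n → ℕ) (k : ℕ) : List (Fin n) → Set where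
    below : ∀ {F} → All (λ x → p x < k) F → SplitsAt p k F
    above : ∀ {x F} → k ≤ p x → SplitsAt p k F → SplitsAt p k (x ∷ F)

  DomBelow : State → Fin n → Fin n → Set
  DomBelow s c y = ∀ x → x ∈ stack s → pre s y ≤ pre s x → pre s x < pre s c → low s y ≤∞ low s x

  -- Dominance of the head of the path makes the pop at its postvisit stop exactly below
  -- the vertices pushed after it.
  Dom : State → Fin n → Set
  Dom s h = ∀ x → x ∈ stack s → pre s h ≤ pre s x → low s h ≤∞ low s x

  TreePath : State → Fin n → List (Fin n) → Set
  TreePath s c [] = parent s c ≡ nothing
  TreePath s c (y ∷ r) =
    (Σ (Fin m) λ a → parent s c ≡ just a × src a ≡ y × tgt a ≡ c × trav s a ≡ true)
    × pre s y < pre s c × DomBelow s c y × TreePath s y r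

  ActivePath : State → List (Fin n) → Set
  ActivePath s [] = ⊤
  ActivePath s (c ∷ r) = TreePath s c r

  HeadDom : State → List (Fin n) → Set
  HeadDom s [] = ⊤
  HeadDom s (h ∷ _) = Dom s h

  OnPath : State → Fin n → Set
  OnPath s y = pre s y ≢ 0 × IsFin (low s y) × y ∉ stack s × SplitsAt (pre s) (pre s y) (stack s)

  OnStack : State → Fin n → Set
  OnStack s x = pre s x ≢ 0 × IsFin (low s x) × (∀ a → src a ≡ x → trav s a ≡ true) × lowArc s x ≢ nothing

  -- A traversed arc is accounted for: its target is completed, or its retreat has made
  -- low (src a) ≤ pre (tgt a), or it is the tree arc into a vertex of P still to retreat on.
  Settled : State → List (Fin n) → Fin m → Set
  Settled s P a = pre s (src a) ≢ 0 × pre s (tgt a) ≢ 0 ×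
    (low s (tgt a) ≡ ∞ ⊎ (Σ ℕ λ k → low s (src a) ≡ fin k × k ≤ pre s (tgt a))
       ⊎ (tgt a ∈ P × parent s (tgt a) ≡ just a))

  -- P is the tree path from the current vertex down to its root, L and Tm are the ghost
  -- variables of the header, and completed vertices are those with low ∞.
  record Core (s : State) (P : List (Fin n)) (L Tm : Fin n → ℕ) (clk : ℕ) : Set where
    field
      cur≡head : cur s ≡ head P
      path-tree : ActivePath s P
      path-ok : All (OnPath s) P
      stack-ok : All (OnStack s) (stack s)
      active : ∀ x → pre s x ≢ 0 → low s x ≢ ∞ → x ∈ P ⊎ x ∈ stack s
      ∞-closed : ∀ a → pre s (src a) ≢ 0 → low s (src a) ≡ ∞ → pre s (tgt a) ≢ 0 × low s (tgt a) ≡ ∞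
      fresh : ∀ x → pre s x ≡ 0 → low s x ≡ ∞ × lowArc s x ≡ nothing
      low≤pre : ∀ x k → low s x ≡ fin k → k ≤ pre s x
      pre<next : ∀ x → pre s x < next s
      lowArc-none : ∀ x → lowArc s x ≡ nothing → low s x ≡ ∞ ⊎ low s x ≡ fin (pre s x)
      lowArc-none-leader : ∀ x → lowArc s x ≡ nothing → pre s x ≢ 0 → x ∉ P →
             low s x ≡ ∞ × (∀ w → MutuallyReachable x w → pre s x ≤ pre s w)
      lowArc-src : ∀ v a → lowArc s v ≡ just a → src a ≡ v
      lowArc-tgt : ∀ v a → lowArc s v ≡ just a → pre s (tgt a) ≢ 0
      descent : ∀ v a → lowArc s v ≡ just a → (L (tgt a) , Tm (tgt a)) <ₗₑₓ (L v , Tm v)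
      ghost-low : ∀ v k → low s v ≡ fin k → L v ≡ k
      stamp<clk : ∀ v → Tm v < clk

  AllSettled : State → List (Fin n) → Set
  AllSettled s P = ∀ b → trav s b ≡ true → Settled s P b

  record Inv (s : State) (P : List (Fin n)) (L Tm : Fin n → ℕ) (clk : ℕ) : Set where
    field
      core : Core s P L Tm clk
      settled : AllSettled s P
      head-dom : HeadDom s P

  ∃Inv : State → Set
  ∃Inv s = Σ (List (Fin n)) λ P → Σ (Fin n → ℕ) λ L → Σ (Fin n → ℕ) λ Tm → Σ ℕ λ clk → Inv s P L Tm clk

  path-pre-< : ∀ s c r → TreePath s c r → ∀ y → y ∈ r → pre s y < pre s c
  path-pre-< s c [] p y ()
  path-pre-< s c (y′ ∷ r) (_ , lt , _ , p) y (here refl) = lt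
  path-pre-< s c (y′ ∷ r) (_ , lt , _ , p) y (there i) = <-trans (path-pre-< s y′ r p y i) lt

  path-pre-≤ : ∀ s c r → TreePath s c r → ∀ y → y ∈ c ∷ r → pre s y ≤ pre s c
  path-pre-≤ s c r p y (here refl) = ≤-refl
  path-pre-≤ s c r p y (there i) = <⇒≤ (path-pre-< s c r p y i)

  parent-on-path : ∀ s P → ActivePath s P → ∀ y a → y ∈ P → parent s y ≡ just a → src a ∈ P × pre s (src a) < pre s y
  parent-on-path s [] _ y a () e
  parent-on-path s (c ∷ []) p y a (here refl) e with trans (sym p) e
  ... | ()
  parent-on-path s (c ∷ y′ ∷ r) ((a′ , pa , sa , ta , _) , lt , _ , _) y a (here refl) e
    with just-injective (trans (sym pa) e)
  ... | refl = there (here sa) , subst (λ z → pre s z < pre s c) (sym sa) lt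
  parent-on-path s (c ∷ []) p y a (there ()) e
  parent-on-path s (c ∷ y′ ∷ r) (_ , _ , _ , p) y a (there i) e with parent-on-path s (y′ ∷ r) p y a i e
  ... | (i′ , lt) = there i′ , lt

  Reach-trans : ∀ {x y z} → Reach x y → Reach y z → Reach x z
  Reach-trans here q = q
  Reach-trans (step a e p) q = step a e (Reach-trans p q)

  ∞-closed-reach : ∀ s → (∀ a → pre s (src a) ≢ 0 → low s (src a) ≡ ∞ → pre s (tgt a) ≢ 0 × low s (tgt a) ≡ ∞) →
    ∀ {x y} → Reach x y → pre s x ≢ 0 → low s x ≡ ∞ → pre s y ≢ 0 × low s y ≡ ∞
  ∞-closed-reach s cl here v l = v , l
  ∞-closed-reach s cl (step a refl r) v l with cl a v l
  ... | (v′ , l′) = ∞-closed-reach s cl r v′ l′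

  SplitsAt-tail : ∀ {p k x F} → SplitsAt p k (x ∷ F) → SplitsAt p k F
  SplitsAt-tail (below (_ ∷ a)) = below a
  SplitsAt-tail (above _ s) = s

  SplitsAt-drop : ∀ {p k} F1 {F2} → SplitsAt p k (F1 ++ F2) → SplitsAt p k F2
  SplitsAt-drop [] s = s
  SplitsAt-drop (x ∷ F1) s = SplitsAt-drop F1 (SplitsAt-tail s)

  TreePath-transport : ∀ s s′ c r → TreePath s c r →
    (∀ y → y ∈ c ∷ r → pre s′ y ≡ pre s y) →
    (∀ y → y ∈ c ∷ r → parent s′ y ≡ parent s y) →
    (∀ y → y ∈ r → low s′ y ≡ low s y) →
    (∀ b → trav s b ≡ true → trav s′ b ≡ true) →
    (∀ x → x ∈ stack s′ → (x ∈ stack s × low s′ x ≡ low s x × pre s′ x ≡ pre s x) ⊎ pre s c < pre s′ x) →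
    TreePath s′ c r
  TreePath-transport s s′ c [] p pr par lw tm st = trans (par c (here refl)) p
  TreePath-transport s s′ c (y ∷ r) ((a , pa , sa , ta , tr) , lt , dp , p) pr par lw tm st =
    (a , trans (par c (here refl)) pa , sa , ta , tm a tr) ,
    subst₂ _<_ (sym (pr y (there (here refl)))) (sym (pr c (here refl))) lt ,
    dp′ ,
    TreePath-transport s s′ y r p (λ z i → pr z (there i)) (λ z i → par z (there i)) (λ z i → lw z (there i)) tm st′
    where
      dp′ : DomBelow s′ c y
      dp′ x i le lt2 with st x i
      ... | inj₁ (i′ , lx , px) =
        subst₂ _≤∞_ (sym (lw y (here refl))) (sym lx)
          (dp x i′ (subst₂ _≤_ (pr y (there (here refl))) px le) (subst₂ _<_ px (pr c (here refl)) lt2))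
      ... | inj₂ lt3 = ⊥-elim (<-asym lt3 (subst (pre s′ x <_) (pr c (here refl)) lt2))
      st′ : ∀ x → x ∈ stack s′ → (x ∈ stack s × low s′ x ≡ low s x × pre s′ x ≡ pre s x) ⊎ pre s y < pre s′ x
      st′ x i with st x i
      ... | inj₁ q = inj₁ q
      ... | inj₂ q = inj₂ (<-trans lt q)

  SplitsAt-cong : ∀ {p p′ k F} → (∀ x → x ∈ F → p′ x ≡ p x) → SplitsAt p k F → SplitsAt p′ k F
  SplitsAt-cong e (below a) = below (All-map∈ (λ x i q → subst (_< _) (sym (e x i)) q) a)
  SplitsAt-cong e (above le s) = above (subst (_ ≤_) (sym (e _ (here refl))) le) (SplitsAt-cong (λ x i → e x (there i)) s)


module Retreat {n m : ℕ} (G : Digraph n m) where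
  open Digraph G
  open Run G
  open Invariants G

  -- What holds just before a retreat on a, both in case (ii) and after a postvisit: the
  -- invariant, except that a itself need not be settled and the head src a may fail to
  -- dominate the stack where tgt a does.
  record RetreatReady (s : State) (r : List (Fin n)) (L Tm : Fin n → ℕ) (clk : ℕ) (a : Fin m) : Set where
    field
      core : Core s (src a ∷ r) L Tm clk
      settled-but : ∀ b → trav s b ≡ true → b ≢ a → Settled s (src a ∷ r) b
      tgt-visited : pre s (tgt a) ≢ 0
      head-dom-or-tgt : ∀ x → x ∈ stack s → pre s (src a) ≤ pre s x →
                        low s (src a) ≤∞ low s x ⊎ low s (tgt a) ≤∞ low s x

  module NoDecrease {s r L Tm clk a} (ready : RetreatReady s r L Tm clk a)
    (low-src≤ : low s (src a) ≤∞ low s (tgt a)) where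
    open RetreatReady ready renaming (core to c; settled-but to settled; tgt-visited to vt; head-dom-or-tgt to dom)

    settled′ : AllSettled s (src a ∷ r)
    settled′ b tb with b ≟ a | All.lookup (Core.path-ok c) (here refl)
    ... | no b≢a | _ = settled b tb b≢a
    ... | yes refl | (vs , (k , lh) , _ , _) with low s (tgt a) in et
    ... | ∞ = vs , vt , inj₁ refl
    ... | fin j with subst (_≤∞ fin j) lh low-src≤
    ... | fin≤fin k≤j = vs , vt , inj₂ (inj₁ (k , lh , ≤-trans k≤j (Core.low≤pre c (tgt a) j et)))

    head-dom′ : Dom s (src a)
    head-dom′ x i p with dom x i p
    ... | inj₁ q = q
    ... | inj₂ q = ≤∞-trans low-src≤ q

  module Decrease {s r L Tm clk a} (ready : RetreatReady s r L Tm clk a)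
    {j k} (low-tgt : low s (tgt a) ≡ fin j) (low-src : low s (src a) ≡ fin k) (j<k : j < k) where
    open RetreatReady ready renaming (core to c; settled-but to settled; tgt-visited to vt; head-dom-or-tgt to dom)

    h = src a

    s′ : State
    s′ = record s { low = upd (low s) h (low s (tgt a)) ; lowArc = upd (lowArc s) h (just a) }

    L′ Tm′ : Fin n → ℕ
    L′ = upd L h j
    Tm′ = upd Tm h clk

    h-visited : pre s h ≢ 0
    h-visited = proj₁ (All.lookup (Core.path-ok c) (here refl))

    h∉stack : h ∉ stack s
    h∉stack = proj₁ (proj₂ (proj₂ (All.lookup (Core.path-ok c) (here refl))))

    tgt≢h : tgt a ≢ h
    tgt≢h e = <-irrefl refl (subst (_< k) (fin-injective (trans (sym low-tgt) (trans (cong (low s) e) low-src))) j<k)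

    low-h : low s′ h ≡ fin j
    low-h = trans (upd-≡ (low s) h (low s (tgt a))) low-tgt

    lowArc-h : lowArc s′ h ≡ just a
    lowArc-h = upd-≡ (lowArc s) h (just a)

    low-other : ∀ x → x ≢ h → low s′ x ≡ low s x
    low-other x x≢h = upd-≢ (low s) h _ x x≢h

    lowArc-other : ∀ x → x ≢ h → lowArc s′ x ≡ lowArc s x
    lowArc-other x x≢h = upd-≢ (lowArc s) h _ x x≢h

    ∞⇒≢h : ∀ x → low s x ≡ ∞ → x ≢ h
    ∞⇒≢h x e refl = fin≢∞ (trans (sym low-src) e)

    path⇒≢h : ∀ y → y ∈ r → y ≢ h
    path⇒≢h y i refl = <-irrefl refl (path-pre-< s h r (Core.path-tree c) y i)

    stack⇒≢h : ∀ x → x ∈ stack s → x ≢ h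
    stack⇒≢h x i refl = h∉stack i

    active : ∀ x → pre s x ≢ 0 → low s′ x ≢ ∞ → x ∈ h ∷ r ⊎ x ∈ stack s
    active x v ne with x ≡? h
    ... | yes refl = inj₁ (here refl)
    ... | no x≢h = Core.active c x v (λ e → ne (trans (low-other x x≢h) e))

    ∞-closed : ∀ b → pre s (src b) ≢ 0 → low s′ (src b) ≡ ∞ → pre s (tgt b) ≢ 0 × low s′ (tgt b) ≡ ∞
    ∞-closed b v e with src b ≡? h
    ... | yes sb≡h = ⊥-elim (fin≢∞ (trans (sym low-h) (trans (cong (low s′) (sym sb≡h)) e)))
    ... | no sb≢h with Core.∞-closed c b v (trans (sym (low-other (src b) sb≢h)) e)
    ... | (vt′ , et) = vt′ , trans (low-other (tgt b) (∞⇒≢h (tgt b) et)) et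

    fresh : ∀ x → pre s x ≡ 0 → low s′ x ≡ ∞ × lowArc s′ x ≡ nothing
    fresh x z with x ≡? h
    ... | yes refl = ⊥-elim (h-visited z)
    ... | no x≢h with Core.fresh c x z
    ... | (l∞ , none) = trans (low-other x x≢h) l∞ , trans (lowArc-other x x≢h) none

    low≤pre : ∀ x k′ → low s′ x ≡ fin k′ → k′ ≤ pre s x
    low≤pre x k′ e with x ≡? h
    ... | yes refl = subst (_≤ pre s h) (fin-injective (trans (sym low-h) e))
                       (<⇒≤ (<-≤-trans j<k (Core.low≤pre c h k low-src)))
    ... | no x≢h = Core.low≤pre c x k′ (trans (sym (low-other x x≢h)) e)

    lowArc-none : ∀ x → lowArc s′ x ≡ nothing → low s′ x ≡ ∞ ⊎ low s′ x ≡ fin (pre s x)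
    lowArc-none x e with x ≡? h
    ... | yes refl = ⊥-elim (nothing≢just (trans (sym e) lowArc-h))
    ... | no x≢h rewrite low-other x x≢h = Core.lowArc-none c x (trans (sym (lowArc-other x x≢h)) e)

    lowArc-none-leader : ∀ x → lowArc s′ x ≡ nothing → pre s x ≢ 0 → x ∉ h ∷ r →
                         low s′ x ≡ ∞ × (∀ w → MutuallyReachable x w → pre s x ≤ pre s w)
    lowArc-none-leader x e v x∉P with x ≡? h
    ... | yes refl = ⊥-elim (x∉P (here refl))
    ... | no x≢h with Core.lowArc-none-leader c x (trans (sym (lowArc-other x x≢h)) e) v x∉P
    ... | (l∞ , leader) = trans (low-other x x≢h) l∞ , leader

    lowArc-src : ∀ v b → lowArc s′ v ≡ just b → src b ≡ v
    lowArc-src v b e with v ≡? h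
    ... | yes refl = cong src (sym (just-injective (trans (sym lowArc-h) e)))
    ... | no v≢h = Core.lowArc-src c v b (trans (sym (lowArc-other v v≢h)) e)

    lowArc-tgt : ∀ v b → lowArc s′ v ≡ just b → pre s (tgt b) ≢ 0
    lowArc-tgt v b e with v ≡? h
    ... | yes refl = subst (λ z → pre s (tgt z) ≢ 0) (just-injective (trans (sym lowArc-h) e)) vt
    ... | no v≢h = Core.lowArc-tgt c v b (trans (sym (lowArc-other v v≢h)) e)

    descent : ∀ v b → lowArc s′ v ≡ just b → (L′ (tgt b) , Tm′ (tgt b)) <ₗₑₓ (L′ v , Tm′ v)
    descent v b e with v ≡? h
    ... | yes refl with just-injective (trans (sym lowArc-h) e)
    ... | refl rewrite upd-≡ L h j | upd-≡ Tm h clk | upd-≢ L h j (tgt a) tgt≢h | upd-≢ Tm h clk (tgt a) tgt≢h =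
           inj₂ (Core.ghost-low c (tgt a) j low-tgt , Core.stamp<clk c (tgt a))
    descent v b e | no v≢h with Core.descent c v b (trans (sym (lowArc-other v v≢h)) e)
    ... | old rewrite upd-≢ L h j v v≢h | upd-≢ Tm h clk v v≢h with tgt b ≡? h
    ... | no tb≢h rewrite upd-≢ L h j (tgt b) tb≢h | upd-≢ Tm h clk (tgt b) tb≢h = old
    ... | yes tb≡h rewrite tb≡h | upd-≡ L h j | upd-≡ Tm h clk | Core.ghost-low c h k low-src = inj₁ (j<L v old)
      where j<L : ∀ v → (k , Tm h) <ₗₑₓ (L v , Tm v) → j < L v
            j<L v (inj₁ k<L) = <-trans j<k k<L
            j<L v (inj₂ (refl , _)) = j<k

    ghost-low : ∀ v k′ → low s′ v ≡ fin k′ → L′ v ≡ k′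
    ghost-low v k′ e with v ≡? h
    ... | yes refl = trans (upd-≡ L h j) (fin-injective (trans (sym low-h) e))
    ... | no v≢h = trans (upd-≢ L h j v v≢h) (Core.ghost-low c v k′ (trans (sym (low-other v v≢h)) e))

    stamp<clk : ∀ v → Tm′ v < suc clk
    stamp<clk v with v ≡? h
    ... | yes refl = subst (_< suc clk) (sym (upd-≡ Tm h clk)) ≤-refl
    ... | no v≢h = subst (_< suc clk) (sym (upd-≢ Tm h clk v v≢h)) (m<n⇒m<1+n (Core.stamp<clk c v))

    core′ : Core s′ (h ∷ r) L′ Tm′ (suc clk)
    core′ = record
      { cur≡head = Core.cur≡head c
      ; path-tree = TreePath-transport s s′ h r (Core.path-tree c) (λ _ _ → refl) (λ _ _ → refl)
                      (λ y i → low-other y (path⇒≢h y i)) (λ _ t → t)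
                      (λ x i → inj₁ (i , low-other x (stack⇒≢h x i) , refl))
      ; path-ok = path-ok-h ∷
          All-map∈ (λ y i (v , (k′ , e) , y∉F , sp) → v , (k′ , trans (low-other y (path⇒≢h y i)) e) , y∉F , sp)
            (All.tail (Core.path-ok c))
      ; stack-ok = All-map∈ (λ x i (v , (k′ , e) , done , la) →
            v , (k′ , trans (low-other x (stack⇒≢h x i)) e) , done ,
            (λ e′ → la (trans (sym (lowArc-other x (stack⇒≢h x i))) e′)))
          (Core.stack-ok c)
      ; active = active ; ∞-closed = ∞-closed ; fresh = fresh ; low≤pre = low≤pre
      ; pre<next = Core.pre<next c ; lowArc-none = lowArc-none ; lowArc-none-leader = lowArc-none-leader
      ; lowArc-src = lowArc-src ; lowArc-tgt = lowArc-tgt ; descent = descent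
      ; ghost-low = ghost-low ; stamp<clk = stamp<clk }
      where
        path-ok-h : OnPath s′ h
        path-ok-h with All.lookup (Core.path-ok c) (here refl)
        ... | (v , _ , h∉F , sp) = v , (j , low-h) , h∉F , sp

    settled′ : AllSettled s′ (h ∷ r)
    settled′ b tb with b ≟ a
    ... | yes refl = h-visited , vt , inj₂ (inj₁ (j , low-h , Core.low≤pre c (tgt a) j low-tgt))
    ... | no b≢a with settled b tb b≢a
    ... | (v1 , v2 , inj₁ e) = v1 , v2 , inj₁ (trans (low-other (tgt b) (∞⇒≢h (tgt b) e)) e)
    ... | (v1 , v2 , inj₂ (inj₂ q)) = v1 , v2 , inj₂ (inj₂ q)
    ... | (v1 , v2 , inj₂ (inj₁ (k′ , e , le))) with src b ≡? h
    ... | no sb≢h = v1 , v2 , inj₂ (inj₁ (k′ , trans (low-other (src b) sb≢h) e , le))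
    ... | yes sb≡h = v1 , v2 , inj₂ (inj₁ (j , trans (cong (low s′) sb≡h) low-h ,
            ≤-trans (<⇒≤ (subst (j <_) (fin-injective (trans (sym low-src) (trans (cong (low s) (sym sb≡h)) e))) j<k)) le))

    head-dom′ : Dom s′ h
    head-dom′ x i p = subst₂ _≤∞_ (sym low-h) (sym (low-other x (stack⇒≢h x i))) (j≤ (dom x i p))
      where j≤ : low s h ≤∞ low s x ⊎ low s (tgt a) ≤∞ low s x → fin j ≤∞ low s x
            j≤ (inj₁ q) = ≤∞-trans (subst (fin j ≤∞_) (sym low-src) (fin≤fin (<⇒≤ j<k))) q
            j≤ (inj₂ q) = subst (_≤∞ low s x) low-tgt q

  retreat-preserves : ∀ {s r L Tm clk a} → RetreatReady s r L Tm clk a → ∃Inv (retreat s a)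
  retreat-preserves {s} {r} {L} {Tm} {clk} {a} ready with low s (tgt a) <∞ᵇ low s (src a) in eq
  ... | false = src a ∷ r , L , Tm , clk ,
                record { core = RetreatReady.core ready ; settled = settled′ ; head-dom = head-dom′ }
    where open NoDecrease ready (<∞ᵇ-false⇒≥∞ (low s (tgt a)) (low s (src a)) eq)
  ... | true with <∞ᵇ-true⇒< (low s (tgt a)) (low s (src a)) eq | All.lookup (Core.path-ok (RetreatReady.core ready)) (here refl)
  ... | (j , low-tgt , j<) | (_ , (k , low-src) , _) =
        src a ∷ r , L′ , Tm′ , suc clk , record { core = core′ ; settled = settled′ ; head-dom = head-dom′ }
    where open Decrease ready low-tgt low-src (j< k low-src)


module Previsit {n m : ℕ} (G : Digraph n m) where
  open Digraph G
  open Run G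
  open Invariants G

  -- π is the tree arc entering the new vertex w (nothing for a root).
  Link : Fin n → Maybe (Fin m) → (Fin m → Bool) → List (Fin n) → Set
  Link w nothing t [] = ⊤
  Link w (just a) t (v ∷ _) = src a ≡ v × tgt a ≡ w × t a ≡ true
  Link w nothing t (_ ∷ _) = ⊥
  Link w (just a) t [] = ⊥

  Link-[] : ∀ {w t} π → Link w π t [] → π ≡ nothing
  Link-[] nothing _ = refl

  Link-∷ : ∀ {w t v r} π → Link w π t (v ∷ r) → Σ (Fin m) λ a → π ≡ just a × src a ≡ v × tgt a ≡ w × t a ≡ true
  Link-∷ (just a) (sa , ta , t′a) = a , refl , sa , ta , t′a

  visit : State → Fin n → Maybe (Fin m) → (Fin m → Bool) → State
  visit s w π t′ = record s
    { pre = upd (pre s) w (next s) ; low = upd (low s) w (fin (next s)) ; next = suc (next s)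
    ; cur = just w ; parent = upd (parent s) w π ; trav = t′ }

  module Visit (s : State) (P : List (Fin n)) (L Tm : Fin n → ℕ) (clk : ℕ)
    (w : Fin n) (π : Maybe (Fin m)) (t′ : Fin m → Bool) (inv : Inv s P L Tm clk) (w-fresh : pre s w ≡ 0)
    (trav⊆ : ∀ b → trav s b ≡ true → t′ b ≡ true)
    (trav⊇ : ∀ b → t′ b ≡ true → trav s b ≡ true ⊎ π ≡ just b)
    (link : Link w π t′ P) where

    c = Inv.core inv

    s′ : State
    s′ = visit s w π t′

    L′ : Fin n → ℕ
    L′ = upd L w (next s)

    next≢0 : next s ≢ 0
    next≢0 e = <-irrefl refl (subst (_< 0) w-fresh (subst (pre s w <_) e (Core.pre<next c w)))

    visited⇒≢w : ∀ x → pre s x ≢ 0 → x ≢ w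
    visited⇒≢w x v refl = v w-fresh

    path⇒≢w : ∀ x → x ∈ P → x ≢ w
    path⇒≢w x i = visited⇒≢w x (proj₁ (All.lookup (Core.path-ok c) i))

    stack⇒≢w : ∀ x → x ∈ stack s → x ≢ w
    stack⇒≢w x i = visited⇒≢w x (proj₁ (All.lookup (Core.stack-ok c) i))

    pre-other : ∀ x → x ≢ w → pre s′ x ≡ pre s x
    pre-other x x≢w = upd-≢ (pre s) w _ x x≢w

    low-other : ∀ x → x ≢ w → low s′ x ≡ low s x
    low-other x x≢w = upd-≢ (low s) w _ x x≢w

    parent-other : ∀ x → x ≢ w → parent s′ x ≡ parent s x
    parent-other x x≢w = upd-≢ (parent s) w _ x x≢w

    pre-w : pre s′ w ≡ next s
    pre-w = upd-≡ (pre s) w _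

    low-w : low s′ w ≡ fin (next s)
    low-w = upd-≡ (low s) w _

    pre-mono : ∀ y → pre s y ≤ pre s′ y
    pre-mono y with y ≡? w
    ... | yes refl = subst (_≤ pre s′ w) (sym w-fresh) z≤n
    ... | no y≢w = ≤-reflexive (sym (pre-other y y≢w))

    path-tree : ∀ P′ → Link w π t′ P′ → ActivePath s P′ → HeadDom s P′ → All (OnPath s) P′ → TreePath s′ w P′
    path-tree [] lk _ _ _ = trans (upd-≡ (parent s) w _) (Link-[] π lk)
    path-tree (v ∷ r) lk tp dom ok with Link-∷ π lk
    ... | (a , πa , sa , ta , t′a) =
      (a , trans (upd-≡ (parent s) w _) πa , sa , ta , t′a) ,
      subst₂ _<_ (sym (pre-other v (≢w (here refl)))) (sym pre-w) (Core.pre<next c v) ,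
      dom-below ,
      TreePath-transport s s′ v r tp (λ y i → pre-other y (≢w i)) (λ y i → parent-other y (≢w i))
        (λ y i → low-other y (≢w (there i))) trav⊆
        (λ x i → inj₁ (i , low-other x (stack⇒≢w x i) , pre-other x (stack⇒≢w x i)))
      where
        ≢w : ∀ {y} → y ∈ v ∷ r → y ≢ w
        ≢w {y} i = visited⇒≢w y (proj₁ (All.lookup ok i))
        dom-below : DomBelow s′ w v
        dom-below x i le _ = subst₂ _≤∞_ (sym (low-other v (≢w (here refl)))) (sym (low-other x (stack⇒≢w x i)))
                               (dom x i (subst₂ _≤_ (pre-other v (≢w (here refl))) (pre-other x (stack⇒≢w x i)) le))

    path-ok-w : OnPath s′ w
    path-ok-w = subst (_≢ 0) (sym pre-w) next≢0 , (next s , low-w) , (λ i → stack⇒≢w w i refl) ,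
                below (All-map∈ (λ x i _ → subst₂ _<_ (sym (pre-other x (stack⇒≢w x i))) (sym pre-w)
                                             (Core.pre<next c x))
                                (Core.stack-ok c))

    path-ok : All (OnPath s′) P
    path-ok = All-map∈ (λ y i (v , (k , e) , y∉F , sp) →
      subst (_≢ 0) (sym (pre-other y (path⇒≢w y i))) v , (k , trans (low-other y (path⇒≢w y i)) e) , y∉F ,
      subst (λ z → SplitsAt (pre s′) z (stack s)) (sym (pre-other y (path⇒≢w y i)))
        (SplitsAt-cong (λ x j → pre-other x (stack⇒≢w x j)) sp)) (Core.path-ok c)

    stack-ok : All (OnStack s′) (stack s)
    stack-ok = All-map∈ (λ x i (v , (k , e) , done , la) →
      subst (_≢ 0) (sym (pre-other x (stack⇒≢w x i))) v , (k , trans (low-other x (stack⇒≢w x i)) e) ,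
      (λ a sa → trav⊆ a (done a sa)) , la) (Core.stack-ok c)

    active : ∀ x → pre s′ x ≢ 0 → low s′ x ≢ ∞ → x ∈ w ∷ P ⊎ x ∈ stack s
    active x v ne with x ≡? w
    ... | yes refl = inj₁ (here refl)
    ... | no x≢w with Core.active c x (subst (_≢ 0) (pre-other x x≢w) v) (subst (_≢ ∞) (low-other x x≢w) ne)
    ... | inj₁ i = inj₁ (there i)
    ... | inj₂ i = inj₂ i

    ∞-closed : ∀ b → pre s′ (src b) ≢ 0 → low s′ (src b) ≡ ∞ → pre s′ (tgt b) ≢ 0 × low s′ (tgt b) ≡ ∞
    ∞-closed b v e with src b ≡? w
    ... | yes sb≡w = ⊥-elim (fin≢∞ (trans (sym low-w) (trans (cong (low s′) (sym sb≡w)) e)))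
    ... | no sb≢w with Core.∞-closed c b (subst (_≢ 0) (pre-other _ sb≢w) v) (trans (sym (low-other _ sb≢w)) e)
    ... | (vt , et) = subst (_≢ 0) (sym (pre-other _ (visited⇒≢w _ vt))) vt ,
                      trans (low-other _ (visited⇒≢w _ vt)) et

    fresh : ∀ x → pre s′ x ≡ 0 → low s′ x ≡ ∞ × lowArc s x ≡ nothing
    fresh x z with x ≡? w
    ... | yes refl = ⊥-elim (next≢0 (trans (sym pre-w) z))
    ... | no x≢w with Core.fresh c x (trans (sym (pre-other x x≢w)) z)
    ... | (l∞ , none) = trans (low-other x x≢w) l∞ , none

    low≤pre : ∀ x k → low s′ x ≡ fin k → k ≤ pre s′ x
    low≤pre x k e with x ≡? w
    ... | yes refl = ≤-reflexive (trans (sym (fin-injective (trans (sym low-w) e))) (sym pre-w))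
    ... | no x≢w = subst (k ≤_) (sym (pre-other x x≢w)) (Core.low≤pre c x k (trans (sym (low-other x x≢w)) e))

    pre<next : ∀ x → pre s′ x < suc (next s)
    pre<next x with x ≡? w
    ... | yes refl = subst (_< suc (next s)) (sym pre-w) ≤-refl
    ... | no x≢w = subst (_< suc (next s)) (sym (pre-other x x≢w)) (m<n⇒m<1+n (Core.pre<next c x))

    lowArc-none : ∀ x → lowArc s x ≡ nothing → low s′ x ≡ ∞ ⊎ low s′ x ≡ fin (pre s′ x)
    lowArc-none x e with x ≡? w
    ... | yes refl = inj₂ (trans low-w (cong fin (sym pre-w)))
    ... | no x≢w rewrite low-other x x≢w | pre-other x x≢w = Core.lowArc-none c x e

    lowArc-none-leader : ∀ x → lowArc s x ≡ nothing → pre s′ x ≢ 0 → x ∉ w ∷ P →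
                         low s′ x ≡ ∞ × (∀ y → MutuallyReachable x y → pre s′ x ≤ pre s′ y)
    lowArc-none-leader x e v x∉P with x ≡? w
    ... | yes refl = ⊥-elim (x∉P (here refl))
    ... | no x≢w with Core.lowArc-none-leader c x e (subst (_≢ 0) (pre-other x x≢w) v) (λ i → x∉P (there i))
    ... | (l∞ , leader) = trans (low-other x x≢w) l∞ ,
          (λ y xy → subst (_≤ pre s′ y) (sym (pre-other x x≢w)) (≤-trans (leader y xy) (pre-mono y)))

    lowArc-tgt : ∀ v b → lowArc s v ≡ just b → pre s′ (tgt b) ≢ 0
    lowArc-tgt v b e = subst (_≢ 0) (sym (pre-other (tgt b) (visited⇒≢w _ (Core.lowArc-tgt c v b e))))
                         (Core.lowArc-tgt c v b e)

    descent : ∀ v b → lowArc s v ≡ just b → (L′ (tgt b) , Tm (tgt b)) <ₗₑₓ (L′ v , Tm v)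
    descent v b e
      rewrite upd-≢ L w (next s) (tgt b) (visited⇒≢w _ (Core.lowArc-tgt c v b e))
            | upd-≢ L w (next s) v (λ { refl → nothing≢just (trans (sym (proj₂ (Core.fresh c w w-fresh))) e) })
      = Core.descent c v b e

    ghost-low : ∀ v k → low s′ v ≡ fin k → L′ v ≡ k
    ghost-low v k e with v ≡? w
    ... | yes refl = trans (upd-≡ L w _) (fin-injective (trans (sym low-w) e))
    ... | no v≢w = trans (upd-≢ L w _ v v≢w) (Core.ghost-low c v k (trans (sym (low-other v v≢w)) e))

    core′ : Core s′ (w ∷ P) L′ Tm clk
    core′ = record
      { cur≡head = refl
      ; path-tree = path-tree P link (Core.path-tree c) (Inv.head-dom inv) (Core.path-ok c)
      ; path-ok = path-ok-w ∷ path-ok ; stack-ok = stack-ok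
      ; active = active ; ∞-closed = ∞-closed ; fresh = fresh ; low≤pre = low≤pre ; pre<next = pre<next
      ; lowArc-none = lowArc-none ; lowArc-none-leader = lowArc-none-leader
      ; lowArc-src = Core.lowArc-src c ; lowArc-tgt = lowArc-tgt ; descent = descent
      ; ghost-low = ghost-low ; stamp<clk = Core.stamp<clk c }

    settled-old : ∀ {b} → Settled s P b → Settled s′ (w ∷ P) b
    settled-old (vs , vt , inj₁ e) =
      subst (_≢ 0) (sym (pre-other _ (visited⇒≢w _ vs))) vs , subst (_≢ 0) (sym (pre-other _ (visited⇒≢w _ vt))) vt ,
      inj₁ (trans (low-other _ (visited⇒≢w _ vt)) e)
    settled-old (vs , vt , inj₂ (inj₁ (k , e , le))) =
      subst (_≢ 0) (sym (pre-other _ (visited⇒≢w _ vs))) vs , subst (_≢ 0) (sym (pre-other _ (visited⇒≢w _ vt))) vt ,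
      inj₂ (inj₁ (k , trans (low-other _ (visited⇒≢w _ vs)) e , subst (k ≤_) (sym (pre-other _ (visited⇒≢w _ vt))) le))
    settled-old (vs , vt , inj₂ (inj₂ (i , pe))) =
      subst (_≢ 0) (sym (pre-other _ (visited⇒≢w _ vs))) vs , subst (_≢ 0) (sym (pre-other _ (visited⇒≢w _ vt))) vt ,
      inj₂ (inj₂ (there i , trans (parent-other _ (visited⇒≢w _ vt)) pe))

    settled-tree : ∀ {b} → π ≡ just b → ∀ P′ → Link w π t′ P′ → All (OnPath s) P′ → Settled s′ (w ∷ P) b
    settled-tree πb (v ∷ r) lk ok with Link-∷ π lk
    ... | (a , πa , sa , ta , _) with just-injective (trans (sym πa) πb)
    ... | refl = subst (_≢ 0) (sym (pre-other _ (visited⇒≢w _ vs))) vs ,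
                 subst (λ z → pre s′ z ≢ 0) (sym ta) (subst (_≢ 0) (sym pre-w) next≢0) ,
                 inj₂ (inj₂ (subst (_∈ w ∷ P) (sym ta) (here refl) ,
                             trans (cong (parent s′) ta) (trans (upd-≡ (parent s) w _) πa)))
      where vs : pre s (src a) ≢ 0
            vs = subst (λ z → pre s z ≢ 0) (sym sa) (proj₁ (All.lookup ok (here refl)))
    settled-tree πb [] lk _ with trans (sym (Link-[] π lk)) πb
    ... | ()

    settled′ : AllSettled s′ (w ∷ P)
    settled′ b tb with trav⊇ b tb
    ... | inj₁ tb′ = settled-old (Inv.settled inv b tb′)
    ... | inj₂ πb = settled-tree πb P link (Core.path-ok c)

    head-dom′ : Dom s′ w
    head-dom′ x i le = ⊥-elim (<⇒≱ (subst₂ _<_ (sym (pre-other x (stack⇒≢w x i))) (sym pre-w) (Core.pre<next c x)) le)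

  previsit-preserves : ∀ s P L Tm clk w (π : Maybe (Fin m)) (t′ : Fin m → Bool) →
    Inv s P L Tm clk → pre s w ≡ 0 →
    (∀ b → trav s b ≡ true → t′ b ≡ true) →
    (∀ b → t′ b ≡ true → trav s b ≡ true ⊎ π ≡ just b) →
    Link w π t′ P → ∃Inv (visit s w π t′)
  previsit-preserves s P L Tm clk w π t′ inv w-fresh trav⊆ trav⊇ link =
    w ∷ P , L′ , Tm , clk , record { core = core′ ; settled = settled′ ; head-dom = head-dom′ }
    where open Visit s P L Tm clk w π t′ inv w-fresh trav⊆ trav⊇ link


module Postvisit {n m : ℕ} (G : Digraph n m) where
  open Digraph G
  open Run G
  open Invariants G
  open import Data.List.Membership.DecPropositional {A = Fin n} _≟_ using (_∈?_)

  record PopSplit (pr : Fin n → ℕ) (p : ℕ) (l : Fin n → ℕ∞) (F : List (Fin n))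
                  (result : (Fin n → ℕ∞) × List (Fin n)) : Set where
    field
      popped : List (Fin n)
      stack≡ : F ≡ popped ++ proj₂ result
      popped-high : All (λ x → p ≤ pr x) popped
      kept-low : All (λ x → pr x < p) (proj₂ result)
      popped-∞ : ∀ x → x ∈ popped → proj₁ result x ≡ ∞
      others-kept : ∀ x → x ∉ popped → proj₁ result x ≡ l x

  popF-splits : ∀ (pr : Fin n → ℕ) p (l : Fin n → ℕ∞) t F → SplitsAt pr p F →
    (∀ x → x ∈ F → p ≤ pr x → (l x <∞ᵇ t) ≡ false) →
    (∀ x → x ∈ F → pr x < p → (l x <∞ᵇ t) ≡ true) →
    PopSplit pr p l F (popF l t F)
  popF-splits pr p l t [] _ _ _ = record
    { popped = [] ; stack≡ = refl ; popped-high = [] ; kept-low = []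
    ; popped-∞ = λ _ () ; others-kept = λ _ _ → refl }
  popF-splits pr p l t (x ∷ xs) (below (px ∷ rest)) _ low<t rewrite low<t x (here refl) px = record
    { popped = [] ; stack≡ = refl ; popped-high = [] ; kept-low = px ∷ rest
    ; popped-∞ = λ _ () ; others-kept = λ _ _ → refl }
  popF-splits pr p l t (x ∷ xs) (above p≤x sp) high≮t low<t rewrite high≮t x (here refl) p≤x =
    record
      { popped = x ∷ popped ; stack≡ = cong (x ∷_) stack≡ ; popped-high = p≤x ∷ popped-high
      ; kept-low = kept-low ; popped-∞ = popped-∞′ ; others-kept = others-kept′ }
    where
      high≮t′ : ∀ y → y ∈ xs → p ≤ pr y → (upd l x ∞ y <∞ᵇ t) ≡ false
      high≮t′ y i p≤y with y ≡? x
      ... | yes refl rewrite upd-≡ l x ∞ = refl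
      ... | no y≢x rewrite upd-≢ l x ∞ y y≢x = high≮t y (there i) p≤y
      low<t′ : ∀ y → y ∈ xs → pr y < p → (upd l x ∞ y <∞ᵇ t) ≡ true
      low<t′ y i y<p with y ≡? x
      ... | yes refl = ⊥-elim (<⇒≱ y<p p≤x)
      ... | no y≢x rewrite upd-≢ l x ∞ y y≢x = low<t y (there i) y<p
      open PopSplit (popF-splits pr p (upd l x ∞) t xs sp high≮t′ low<t′)
      popped-∞′ : ∀ z → z ∈ x ∷ popped → proj₁ (popF (upd l x ∞) t xs) z ≡ ∞
      popped-∞′ z (there i) = popped-∞ z i
      popped-∞′ z (here refl) with z ∈? popped
      ... | yes i = popped-∞ z i
      ... | no z∉ = trans (others-kept z z∉) (upd-≡ l z ∞)
      others-kept′ : ∀ z → z ∉ x ∷ popped → proj₁ (popF (upd l x ∞) t xs) z ≡ l z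
      others-kept′ z z∉ = trans (others-kept z (λ i → z∉ (there i))) (upd-≢ l x ∞ z (λ e → z∉ (here e)))

  -- Dominance of the next head u, up to the retreat on the tree arc into v still pending.
  DomAfterPost : State → List (Fin n) → Fin n → Set
  DomAfterPost s₁ [] v = ⊤
  DomAfterPost s₁ (u ∷ _) v = ∀ x → x ∈ stack s₁ → pre s₁ u ≤ pre s₁ x → low s₁ u ≤∞ low s₁ x ⊎ low s₁ v ≤∞ low s₁ x

  record AfterPost (s₁ : State) (r : List (Fin n)) (L Tm : Fin n → ℕ) (clk : ℕ) (v : Fin n) (pv : Maybe (Fin m)) : Set where
    field
      core : Core s₁ r L Tm clk
      settled-but : ∀ b → trav s₁ b ≡ true → pv ≢ just b → Settled s₁ r b
      dom-after : DomAfterPost s₁ r v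

  TreePath-tail : ∀ s s₁ v r → TreePath s v r →
    (∀ y → y ∈ r → pre s₁ y ≡ pre s y) → (∀ y → y ∈ r → parent s₁ y ≡ parent s y) →
    (∀ y → y ∈ r → low s₁ y ≡ low s y) → (∀ b → trav s b ≡ true → trav s₁ b ≡ true) →
    (∀ x → x ∈ stack s₁ → (x ∈ stack s × low s₁ x ≡ low s x × pre s₁ x ≡ pre s x) ⊎ pre s v ≤ pre s₁ x) →
    ActivePath s₁ r
  TreePath-tail s s₁ v [] _ _ _ _ _ _ = tt
  TreePath-tail s s₁ v (u ∷ r′) (_ , u<v , _ , tp) pr par lw tm st =
    TreePath-transport s s₁ u r′ tp pr par (λ y i → lw y (there i)) tm st′
    where st′ : ∀ x → x ∈ stack s₁ → (x ∈ stack s × low s₁ x ≡ low s x × pre s₁ x ≡ pre s x) ⊎ pre s u < pre s₁ x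
          st′ x i with st x i
          ... | inj₁ q = inj₁ q
          ... | inj₂ q = inj₂ (<-≤-trans u<v q)

  DomAfterPost-push : ∀ s v r → TreePath s v r → Dom s v →
                      DomAfterPost (record s { stack = v ∷ stack s ; cur = head r }) r v
  DomAfterPost-push s v [] _ _ = tt
  DomAfterPost-push s v (u ∷ r′) _ _ x (here refl) _ = inj₂ (≤∞-refl _)
  DomAfterPost-push s v (u ∷ r′) (_ , _ , dom-below , _) dom x (there i) u≤x with pre s x <? pre s v
  ... | yes x<v = inj₁ (dom-below x i u≤x x<v)
  ... | no x≮v = inj₂ (dom x i (≮⇒≥ x≮v))

  DomAfterPost-pop : ∀ s s₁ v r → TreePath s v r → (∀ y → pre s₁ y ≡ pre s y) → (∀ y → y ∈ r → low s₁ y ≡ low s y) →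
    (∀ x → x ∈ stack s₁ → x ∈ stack s × low s₁ x ≡ low s x × pre s x < pre s v) → DomAfterPost s₁ r v
  DomAfterPost-pop s s₁ v [] _ _ _ _ = tt
  DomAfterPost-pop s s₁ v (u ∷ r′) (_ , _ , dom-below , _) pr lw st x i u≤x with st x i
  ... | (i′ , lx , x<v) = inj₁ (subst₂ _≤∞_ (sym (lw u (here refl))) (sym lx)
                            (dom-below x i′ (subst₂ _≤_ (pr u) (pr x) u≤x) x<v))

  module Push (s : State) (v : Fin n) (r : List (Fin n)) (L Tm : Fin n → ℕ) (clk : ℕ)
    (inv : Inv s (v ∷ r) L Tm clk) (all-trav : ∀ a → src a ≡ v → trav s a ≡ true)
    (low≢pre : (low s v ≡∞ᵇ fin (pre s v)) ≡ false) where

    c = Inv.core inv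

    s₁ : State
    s₁ = record s { stack = v ∷ stack s ; cur = head r }

    path⇒≢v : ∀ y → y ∈ r → y ≢ v
    path⇒≢v y i refl = <-irrefl refl (path-pre-< s v r (Core.path-tree c) y i)

    v-lowArc : lowArc s v ≢ nothing
    v-lowArc e with Core.lowArc-none c v e | All.lookup (Core.path-ok c) (here refl)
    ... | inj₁ l∞ | (_ , (_ , lf) , _) = fin≢∞ (trans (sym lf) l∞)
    ... | inj₂ l≡pre | _ = ≡∞ᵇ-false⇒≢ _ _ low≢pre l≡pre

    active : ∀ x → pre s x ≢ 0 → low s x ≢ ∞ → x ∈ r ⊎ x ∈ v ∷ stack s
    active x vx ne with Core.active c x vx ne
    ... | inj₁ (here e) = inj₂ (here e)
    ... | inj₁ (there i) = inj₁ i
    ... | inj₂ i = inj₂ (there i)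

    core′ : Core s₁ r L Tm clk
    core′ = record
      { cur≡head = refl
      ; path-tree = TreePath-tail s s₁ v r (Core.path-tree c) (λ _ _ → refl) (λ _ _ → refl) (λ _ _ → refl) (λ _ t → t)
                      (λ { x (here refl) → inj₂ ≤-refl ; x (there i) → inj₁ (i , refl , refl) })
      ; path-ok = All-map∈ (λ y i (vy , fy , y∉F , sp) → vy , fy ,
                      (λ { (here e) → path⇒≢v y i e ; (there j) → y∉F j }) ,
                      above (<⇒≤ (path-pre-< s v r (Core.path-tree c) y i)) sp)
                    (All.tail (Core.path-ok c))
      ; stack-ok = (proj₁ pv , proj₁ (proj₂ pv) , all-trav , v-lowArc) ∷ Core.stack-ok c
      ; active = active ; ∞-closed = Core.∞-closed c ; fresh = Core.fresh c ; low≤pre = Core.low≤pre c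
      ; pre<next = Core.pre<next c ; lowArc-none = Core.lowArc-none c
      ; lowArc-none-leader = λ x e vx x∉r →
          Core.lowArc-none-leader c x e vx (λ { (here refl) → v-lowArc e ; (there i) → x∉r i })
      ; lowArc-src = Core.lowArc-src c ; lowArc-tgt = Core.lowArc-tgt c ; descent = Core.descent c
      ; ghost-low = Core.ghost-low c ; stamp<clk = Core.stamp<clk c }
      where pv = All.lookup (Core.path-ok c) (here refl)

    settled-but : ∀ b → trav s b ≡ true → parent s v ≢ just b → Settled s₁ r b
    settled-but b tb not-tree with Inv.settled inv b tb
    ... | (v1 , v2 , inj₁ e) = v1 , v2 , inj₁ e
    ... | (v1 , v2 , inj₂ (inj₁ q)) = v1 , v2 , inj₂ (inj₁ q)
    ... | (v1 , v2 , inj₂ (inj₂ (here e , pe))) = ⊥-elim (not-tree (subst (λ z → parent s z ≡ just b) e pe))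
    ... | (v1 , v2 , inj₂ (inj₂ (there i , pe))) = v1 , v2 , inj₂ (inj₂ (i , pe))

    dom-after : DomAfterPost s₁ r v
    dom-after = DomAfterPost-push s v r (Core.path-tree c) (Inv.head-dom inv)

  module Pop (s : State) (v : Fin n) (r : List (Fin n)) (L Tm : Fin n → ℕ) (clk : ℕ)
    (inv : Inv s (v ∷ r) L Tm clk) (all-trav : ∀ a → src a ≡ v → trav s a ≡ true)
    (low≡pre : (low s v ≡∞ᵇ fin (pre s v)) ≡ true) where

    c = Inv.core inv
    p = pre s v
    F = stack s

    low-v : low s v ≡ fin p
    low-v = ≡∞ᵇ-true⇒≡ _ _ low≡pre

    split : PopSplit (pre s) p (low s) F (popF (low s) (low s v) F)
    split = popF-splits (pre s) p (low s) (low s v) F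
              (proj₂ (proj₂ (proj₂ (All.lookup (Core.path-ok c) (here refl))))) high≮low-v low<low-v
      where
        high≮low-v : ∀ x → x ∈ F → p ≤ pre s x → (low s x <∞ᵇ low s v) ≡ false
        high≮low-v x i p≤x = ≤∞⇒≮∞ᵇ (low s v) (low s x) (Inv.head-dom inv x i p≤x)
        low<low-v : ∀ x → x ∈ F → pre s x < p → (low s x <∞ᵇ low s v) ≡ true
        low<low-v x i x<p with All.lookup (Core.stack-ok c) i
        ... | (_ , (k , lx) , _ , _) = subst₂ (λ a b → (a <∞ᵇ b) ≡ true) (sym lx) (sym low-v)
                                         (<⇒<∞ᵇ k p (≤-<-trans (Core.low≤pre c x k lx) x<p))

    open PopSplit split

    kept = proj₂ (popF (low s) (low s v) F)

    low₁ : Fin n → ℕ∞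
    low₁ = upd (proj₁ (popF (low s) (low s v) F)) v ∞

    s₁ : State
    s₁ = record s { low = low₁ ; stack = kept ; cur = head r }

    -- Contains the strong component of v.
    Popped : Fin n → Set
    Popped x = x ≡ v ⊎ x ∈ popped

    popped⊆F : ∀ {x} → x ∈ popped → x ∈ F
    popped⊆F i = subst (_ ∈_) (sym stack≡) (∈-++⁺ˡ i)

    kept⊆F : ∀ {x} → x ∈ kept → x ∈ F
    kept⊆F i = subst (_ ∈_) (sym stack≡) (∈-++⁺ʳ popped i)

    low₁-cases : ∀ x → (Popped x × low₁ x ≡ ∞) ⊎ (¬ Popped x × low₁ x ≡ low s x)
    low₁-cases x with x ≡? v
    ... | yes refl = inj₁ (inj₁ refl , upd-≡ _ v ∞)
    ... | no x≢v with x ∈? popped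
    ... | yes i = inj₁ (inj₂ i , trans (upd-≢ _ v ∞ x x≢v) (popped-∞ x i))
    ... | no x∉ = inj₂ ((λ { (inj₁ e) → x≢v e ; (inj₂ i) → x∉ i }) , trans (upd-≢ _ v ∞ x x≢v) (others-kept x x∉))

    ∞-stays : ∀ x → low s x ≡ ∞ → low₁ x ≡ ∞
    ∞-stays x e with low₁-cases x
    ... | inj₁ (_ , q) = q
    ... | inj₂ (_ , q) = trans q e

    unpopped-kept : ∀ x → ¬ Popped x → low₁ x ≡ low s x
    unpopped-kept x x∉ with low₁-cases x
    ... | inj₁ (i , _) = ⊥-elim (x∉ i)
    ... | inj₂ (_ , q) = q

    path⇒unpopped : ∀ y → y ∈ r → ¬ Popped y
    path⇒unpopped y i (inj₁ refl) = <-irrefl refl (path-pre-< s v r (Core.path-tree c) y i)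
    path⇒unpopped y i (inj₂ j) = proj₁ (proj₂ (proj₂ (All.lookup (Core.path-ok c) (there i)))) (popped⊆F j)

    kept-pre : ∀ {x} → x ∈ kept → pre s x < p
    kept-pre i = All.lookup kept-low i

    kept⇒unpopped : ∀ x → x ∈ kept → ¬ Popped x
    kept⇒unpopped x i (inj₁ refl) = <-irrefl refl (kept-pre i)
    kept⇒unpopped x i (inj₂ j) = <⇒≱ (kept-pre i) (All.lookup popped-high j)

    Popped-low : ∀ z → Popped z → Σ ℕ λ k → low s z ≡ fin k × p ≤ k
    Popped-low z (inj₁ refl) = p , low-v , ≤-refl
    Popped-low z (inj₂ j) with All.lookup (Core.stack-ok c) (popped⊆F j)
                             | Inv.head-dom inv z (popped⊆F j) (All.lookup popped-high j)
    ... | (_ , (k , lz) , _ , _) | v≤z with subst₂ _≤∞_ low-v lz v≤z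
    ... | fin≤fin p≤k = k , lz , p≤k

    Popped-settled : ∀ z b → Popped z → src b ≡ z → Settled s (v ∷ r) b
    Popped-settled z b (inj₁ refl) sb = Inv.settled inv b (all-trav b sb)
    Popped-settled z b (inj₂ j) sb =
      Inv.settled inv b (proj₁ (proj₂ (proj₂ (All.lookup (Core.stack-ok c) (popped⊆F j)))) b sb)

    -- An arc out of the component to a vertex of finite low comes back into it: that
    -- vertex is active with pre ≥ p, so it is neither on the path below v nor kept.
    Popped-arc : ∀ z b → Popped z → src b ≡ z → low s (tgt b) ≢ ∞ → Popped (tgt b)
    Popped-arc z b pz sb l≢∞ with Popped-settled z b pz sb
    ... | (_ , vt , inj₁ e) = ⊥-elim (l≢∞ e)
    ... | (_ , vt , inj₂ (inj₁ (k , e , k≤t))) with Popped-low z pz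
    ... | (k′ , e′ , p≤k′) with fin-injective (trans (sym e) (trans (cong (low s) sb) e′))
    ... | refl with Core.active c (tgt b) vt l≢∞
    ... | inj₁ (here e₂) = inj₁ e₂
    ... | inj₁ (there i) = ⊥-elim (<⇒≱ (path-pre-< s v r (Core.path-tree c) (tgt b) i) (≤-trans p≤k′ k≤t))
    ... | inj₂ i with ∈-++⁻ popped (subst (_ ∈_) stack≡ i)
    ... | inj₁ j = inj₂ j
    ... | inj₂ j = ⊥-elim (<⇒≱ (kept-pre j) (≤-trans p≤k′ k≤t))
    Popped-arc z b pz sb l≢∞ | (_ , vt , inj₂ (inj₂ (i , pe)))
      with parent-on-path s (v ∷ r) (Core.path-tree c) (tgt b) b i pe | pz
    ... | (_ , lt) | inj₁ refl =
      ⊥-elim (<⇒≱ (subst (λ q → pre s q < pre s (tgt b)) sb lt) (path-pre-≤ s v r (Core.path-tree c) (tgt b) i))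
    ... | (si , _) | inj₂ j =
      ⊥-elim (proj₁ (proj₂ (proj₂ (All.lookup (Core.path-ok c) si))) (subst (_∈ F) (sym sb) (popped⊆F j)))

    Popped-reach : ∀ z w → Popped z → Reach z w → Reach w v → Popped w
    Popped-reach z w pz here _ = pz
    Popped-reach z w pz (step b sb rest) wv with low s (tgt b) in lt
    ... | ∞ = ⊥-elim (fin≢∞ (trans (sym low-v)
                (proj₂ (∞-closed-reach s (Core.∞-closed c) (Reach-trans rest wv)
                         (proj₁ (proj₂ (Popped-settled z b pz sb))) lt))))
    ... | fin _ = Popped-reach (tgt b) w (Popped-arc z b pz sb (λ e → fin≢∞ (trans (sym lt) e))) rest wv

    v-leader : ∀ w → MutuallyReachable v w → pre s v ≤ pre s w
    v-leader w (vw , wv) with Popped-reach v w (inj₁ refl) vw wv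
    ... | inj₁ refl = ≤-refl
    ... | inj₂ j = All.lookup popped-high j

    ∞-closed : ∀ b → pre s (src b) ≢ 0 → low₁ (src b) ≡ ∞ → pre s (tgt b) ≢ 0 × low₁ (tgt b) ≡ ∞
    ∞-closed b vs e with low₁-cases (src b)
    ∞-closed b vs e | inj₂ (_ , q) with Core.∞-closed c b vs (trans (sym q) e)
    ... | (vt , lt) = vt , ∞-stays (tgt b) lt
    ∞-closed b vs e | inj₁ (ps , _) with Popped-settled (src b) b ps refl
    ... | (_ , vt , _) with low s (tgt b) in lt
    ... | ∞ = vt , ∞-stays (tgt b) lt
    ... | fin _ with low₁-cases (tgt b)
    ... | inj₁ (_ , q) = vt , q
    ... | inj₂ (pt , _) = ⊥-elim (pt (Popped-arc (src b) b ps refl (λ e → fin≢∞ (trans (sym lt) e))))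

    active : ∀ x → pre s x ≢ 0 → low₁ x ≢ ∞ → x ∈ r ⊎ x ∈ kept
    active x vx ne with low₁-cases x
    ... | inj₁ (_ , q) = ⊥-elim (ne q)
    ... | inj₂ (px , q) with Core.active c x vx (λ e → ne (trans q e))
    ... | inj₁ (here e) = ⊥-elim (px (inj₁ e))
    ... | inj₁ (there i) = inj₁ i
    ... | inj₂ i with ∈-++⁻ popped (subst (_ ∈_) stack≡ i)
    ... | inj₁ j = ⊥-elim (px (inj₂ j))
    ... | inj₂ j = inj₂ j

    low≤pre : ∀ x k → low₁ x ≡ fin k → k ≤ pre s x
    low≤pre x k e with low₁-cases x
    ... | inj₁ (_ , q) = ⊥-elim (fin≢∞ (trans (sym e) q))
    ... | inj₂ (_ , q) = Core.low≤pre c x k (trans (sym q) e)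

    lowArc-none : ∀ x → lowArc s x ≡ nothing → low₁ x ≡ ∞ ⊎ low₁ x ≡ fin (pre s x)
    lowArc-none x e with low₁-cases x
    ... | inj₁ (_ , q) = inj₁ q
    ... | inj₂ (_ , q) rewrite q = Core.lowArc-none c x e

    lowArc-none-leader : ∀ x → lowArc s x ≡ nothing → pre s x ≢ 0 → x ∉ r →
                         low₁ x ≡ ∞ × (∀ w → MutuallyReachable x w → pre s x ≤ pre s w)
    lowArc-none-leader x e vx x∉r with x ≡? v
    ... | yes refl = upd-≡ _ v ∞ , v-leader
    ... | no x≢v with Core.lowArc-none-leader c x e vx (λ { (here e₂) → x≢v e₂ ; (there i) → x∉r i })
    ... | (l∞ , leader) = ∞-stays x l∞ , leader

    ghost-low : ∀ x k → low₁ x ≡ fin k → L x ≡ k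
    ghost-low x k e with low₁-cases x
    ... | inj₁ (_ , q) = ⊥-elim (fin≢∞ (trans (sym e) q))
    ... | inj₂ (_ , q) = Core.ghost-low c x k (trans (sym q) e)

    core′ : Core s₁ r L Tm clk
    core′ = record
      { cur≡head = refl
      ; path-tree = TreePath-tail s s₁ v r (Core.path-tree c) (λ _ _ → refl) (λ _ _ → refl)
                      (λ y i → unpopped-kept y (path⇒unpopped y i)) (λ _ t → t)
                      (λ x i → inj₁ (kept⊆F i , unpopped-kept x (kept⇒unpopped x i) , refl))
      ; path-ok = All-map∈ (λ y i (vy , (k , ly) , y∉F , sp) →
                      vy , (k , trans (unpopped-kept y (path⇒unpopped y i)) ly) , (λ j → y∉F (kept⊆F j)) ,
                      SplitsAt-drop popped (subst (SplitsAt (pre s) (pre s y)) stack≡ sp))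
                    (All.tail (Core.path-ok c))
      ; stack-ok = All-map∈ (λ x i _ → let (vx , (k , lx) , done , la) = All.lookup (Core.stack-ok c) (kept⊆F i) in
                      vx , (k , trans (unpopped-kept x (kept⇒unpopped x i)) lx) , done , la) kept-low
      ; active = active ; ∞-closed = ∞-closed
      ; fresh = λ x z → ∞-stays x (proj₁ (Core.fresh c x z)) , proj₂ (Core.fresh c x z)
      ; low≤pre = low≤pre ; pre<next = Core.pre<next c
      ; lowArc-none = lowArc-none ; lowArc-none-leader = lowArc-none-leader
      ; lowArc-src = Core.lowArc-src c ; lowArc-tgt = Core.lowArc-tgt c ; descent = Core.descent c
      ; ghost-low = ghost-low ; stamp<clk = Core.stamp<clk c }

    settled-but : ∀ b → trav s b ≡ true → parent s v ≢ just b → Settled s₁ r b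
    settled-but b tb not-tree with Inv.settled inv b tb
    ... | (v1 , v2 , inj₁ e) = v1 , v2 , inj₁ (∞-stays _ e)
    ... | (v1 , v2 , inj₂ (inj₂ (here e , pe))) = ⊥-elim (not-tree (subst (λ z → parent s z ≡ just b) e pe))
    ... | (v1 , v2 , inj₂ (inj₂ (there i , pe))) = v1 , v2 , inj₂ (inj₂ (i , pe))
    ... | (v1 , v2 , inj₂ (inj₁ (k , e , le))) with low₁-cases (src b)
    ... | inj₁ (_ , q) = v1 , v2 , inj₁ (proj₂ (∞-closed b v1 q))
    ... | inj₂ (_ , q) = v1 , v2 , inj₂ (inj₁ (k , trans q e , le))

    dom-after : DomAfterPost s₁ r v
    dom-after = DomAfterPost-pop s s₁ v r (Core.path-tree c) (λ _ → refl)
                  (λ y i → unpopped-kept y (path⇒unpopped y i))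
                  (λ x i → kept⊆F i , unpopped-kept x (kept⇒unpopped x i) , kept-pre i)

  postvisit-preserves : ∀ s v r L Tm clk → Inv s (v ∷ r) L Tm clk → (∀ a → src a ≡ v → trav s a ≡ true) →
     AfterPost (record (postvisit s v) { cur = head r }) r L Tm clk v (parent s v)
  postvisit-preserves s v r L Tm clk inv all-trav with low s v ≡∞ᵇ fin (pre s v) in eq
  ... | false = record { core = core′ ; settled-but = settled-but ; dom-after = dom-after }
    where open Push s v r L Tm clk inv all-trav eq
  ... | true = record { core = core′ ; settled-but = settled-but ; dom-after = dom-after }
    where open Pop s v r L Tm clk inv all-trav eq


module Preservation {n m : ℕ} (G : Digraph n m) where
  open Digraph G
  open Run G
  open Invariants G
  open Retreat G
  open Previsit G
  open Postvisit G

  pre-postvisit : ∀ s v → pre (postvisit s v) ≡ pre s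
  pre-postvisit s v with low s v ≡∞ᵇ fin (pre s v)
  ... | false = refl
  ... | true = refl

  mark-keeps : ∀ (t : Fin m → Bool) a b → t b ≡ true → upd t a true b ≡ true
  mark-keeps t a b tb with b ≡? a
  ... | yes refl = upd-≡ t a true
  ... | no b≢a = trans (upd-≢ t a true b b≢a) tb

  mark-adds : ∀ (t : Fin m → Bool) a b → upd t a true b ≡ true → t b ≡ true ⊎ just a ≡ just b
  mark-adds t a b tb with b ≡? a
  ... | yes refl = inj₂ refl
  ... | no b≢a = inj₁ (trans (sym (upd-≢ t a true b b≢a)) tb)

  Core-trav : ∀ {s P L Tm clk} (t′ : Fin m → Bool) → (∀ b → trav s b ≡ true → t′ b ≡ true) →
              Core s P L Tm clk → Core (record s { trav = t′ }) P L Tm clk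
  Core-trav {s} {P} t′ trav⊆ c = record
    { cur≡head = Core.cur≡head c
    ; path-tree = path-tree P (Core.path-tree c)
    ; path-ok = Core.path-ok c
    ; stack-ok = All-map∈ (λ x i (vx , fx , done , la) → vx , fx , (λ b sb → trav⊆ b (done b sb)) , la) (Core.stack-ok c)
    ; active = Core.active c ; ∞-closed = Core.∞-closed c ; fresh = Core.fresh c ; low≤pre = Core.low≤pre c
    ; pre<next = Core.pre<next c ; lowArc-none = Core.lowArc-none c ; lowArc-none-leader = Core.lowArc-none-leader c
    ; lowArc-src = Core.lowArc-src c ; lowArc-tgt = Core.lowArc-tgt c ; descent = Core.descent c
    ; ghost-low = Core.ghost-low c ; stamp<clk = Core.stamp<clk c }
    where
      path-tree : ∀ P′ → ActivePath s P′ → ActivePath (record s { trav = t′ }) P′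
      path-tree [] _ = tt
      path-tree (h ∷ r) tp = TreePath-transport s (record s { trav = t′ }) h r tp (λ _ _ → refl) (λ _ _ → refl)
                               (λ _ _ → refl) trav⊆ (λ x i → inj₁ (i , refl , refl))

  no-current : ∀ {s P L Tm clk} → Core s P L Tm clk → cur s ≡ nothing → P ≡ []
  no-current c cn = head≡nothing⇒[] _ (trans (sym (Core.cur≡head c)) cn)

  current : ∀ {s P L Tm clk v} → Core s P L Tm clk → cur s ≡ just v → Σ (List (Fin n)) λ r → P ≡ v ∷ r
  current {P = []} c cv with trans (sym cv) (Core.cur≡head c)
  ... | ()
  current {P = x ∷ r} c cv with trans (sym cv) (Core.cur≡head c)
  ... | refl = r , refl

  advance-visited-preserves : ∀ {s r L Tm clk a} → Inv s (src a ∷ r) L Tm clk → pre s (tgt a) ≢ 0 →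
                              ∃Inv (retreat (markTrav s a) a)
  advance-visited-preserves {s} {r} {a = a} inv visited = retreat-preserves record
    { core = Core-trav _ (mark-keeps (trav s) a) (Inv.core inv)
    ; settled-but = λ b tb b≢a → Inv.settled inv b (trans (sym (upd-≢ (trav s) a true b b≢a)) tb)
    ; tgt-visited = visited
    ; head-dom-or-tgt = λ x i le → inj₁ (Inv.head-dom inv x i le) }

  post-tree-preserves : ∀ {s v r L Tm clk a} → Inv s (v ∷ src a ∷ r) L Tm clk →
    (∀ b → src b ≡ v → trav s b ≡ true) → parent s v ≡ just a →
    ∃Inv (retreat (record (postvisit s v) { cur = just (src a) }) a)
  post-tree-preserves {s} {v} {r} {L} {Tm} {clk} {a} inv all-trav pa
    with Core.path-tree (Inv.core inv)
  ... | ((a′ , pa′ , _ , ta , _) , _) with just-injective (trans (sym pa) pa′)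
  ... | refl = retreat-preserves {s₁} record
    { core = core
    ; settled-but = λ b tb b≢a → settled-but b tb (λ e → b≢a (sym (just-injective (trans (sym pa) e))))
    ; tgt-visited = subst (λ f → f (tgt a) ≢ 0) (sym (pre-postvisit s v))
                      (subst (λ z → pre s z ≢ 0) (sym ta) (proj₁ (All.lookup (Core.path-ok (Inv.core inv)) (here refl))))
    ; head-dom-or-tgt = λ y i le → tgt-form (dom-after y i le) }
    where
      s₁ = record (postvisit s v) { cur = just (src a) }
      open AfterPost (postvisit-preserves s v (src a ∷ r) L Tm clk inv all-trav)
      tgt-form : ∀ {y} → low s₁ (src a) ≤∞ low s₁ y ⊎ low s₁ v ≤∞ low s₁ y →
                 low s₁ (src a) ≤∞ low s₁ y ⊎ low s₁ (tgt a) ≤∞ low s₁ y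
      tgt-form (inj₁ q) = inj₁ q
      tgt-form {y} (inj₂ q) = inj₂ (subst (λ z → low s₁ z ≤∞ low s₁ y) (sym ta) q)

  step-preserves : ∀ {s s′} → Step s s′ → ∃Inv s → ∃Inv s′
  step-preserves (start s v cn fresh) (P , L , Tm , clk , inv) with no-current (Inv.core inv) cn
  ... | refl = previsit-preserves s [] L Tm clk v nothing (trav s) inv fresh (λ _ t → t) (λ _ t → inj₁ t) tt
  step-preserves (advVisited s v a cv refl _ visited) (P , L , Tm , clk , inv) with current (Inv.core inv) cv
  ... | r , refl = advance-visited-preserves inv visited
  step-preserves (advTree s v a cv sa _ fresh) (P , L , Tm , clk , inv) with current (Inv.core inv) cv
  ... | r , refl = previsit-preserves s (v ∷ r) L Tm clk (tgt a) (just a) (upd (trav s) a true) inv fresh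
                     (mark-keeps (trav s) a) (mark-adds (trav s) a) (sa , refl , upd-≡ (trav s) a true)
  step-preserves (postRoot s v cv all-trav pn) (P , L , Tm , clk , inv) with current (Inv.core inv) cv
  ... | u ∷ _ , refl = ⊥-elim (nothing≢just (trans (sym pn) (proj₁ (proj₂ (proj₁ (Core.path-tree (Inv.core inv)))))))
  ... | [] , refl = [] , L , Tm , clk , record
    { core = core ; settled = λ b tb → settled-but b tb (λ e → nothing≢just (trans (sym pn) e)) ; head-dom = tt }
    where open AfterPost (postvisit-preserves s v [] L Tm clk inv all-trav)
  step-preserves (postTree s v a cv all-trav pa) (P , L , Tm , clk , inv) with current (Inv.core inv) cv
  ... | [] , refl = ⊥-elim (nothing≢just (trans (sym (Core.path-tree (Inv.core inv))) pa))
  ... | u ∷ r , refl with Core.path-tree (Inv.core inv)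
  ... | ((a′ , pa′ , sa′ , _) , _) with just-injective (trans (sym pa) pa′) | sa′
  ... | refl | refl = post-tree-preserves inv all-trav pa


module Forest {n m : ℕ} (G : Digraph n m) where
  open Digraph G
  open Run G
  open Invariants G
  open Preservation G

  init-inv : ∃Inv init
  init-inv = [] , (λ _ → 0) , (λ _ → 0) , 1 , record
    { core = record
      { cur≡head = refl ; path-tree = tt ; path-ok = [] ; stack-ok = []
      ; active = λ _ v _ → ⊥-elim (v refl)
      ; ∞-closed = λ _ v _ → ⊥-elim (v refl)
      ; fresh = λ _ _ → refl , refl
      ; low≤pre = λ _ _ ()
      ; pre<next = λ _ → s≤s z≤n
      ; lowArc-none = λ _ _ → inj₁ refl
      ; lowArc-none-leader = λ _ _ v _ → ⊥-elim (v refl)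
      ; lowArc-src = λ _ _ () ; lowArc-tgt = λ _ _ () ; descent = λ _ _ ()
      ; ghost-low = λ _ _ ()
      ; stamp<clk = λ _ → s≤s z≤n }
    ; settled = λ _ ()
    ; head-dom = tt }

  run-preserves : ∀ {s s′} → Star Step s s′ → ∃Inv s → ∃Inv s′
  run-preserves ε inv = inv
  run-preserves (st ◅ sts) inv = run-preserves sts (step-preserves st inv)

  final-core : ∀ {s} → Reachable s → cur s ≡ nothing → Σ (Fin n → ℕ) λ L → Σ (Fin n → ℕ) λ Tm → Σ ℕ λ clk → Core s [] L Tm clk
  final-core run cn with run-preserves run init-inv
  ... | P , L , Tm , clk , inv with no-current (Inv.core inv) cn
  ... | refl = L , Tm , clk , Inv.core inv

  module LowArcs {s P L Tm clk} (c : Core s P L Tm clk) where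

    lowArc-descends : ∀ {a} → LowArcs s a → (L (tgt a) , Tm (tgt a)) <ₗₑₓ (L (src a) , Tm (src a))
    lowArc-descends {a} (u , _ , ua) with Core.lowArc-src c u a ua
    ... | refl = Core.descent c u a ua

    walk-descends : ∀ {x y} → Walk (LowArcs s) x y → x ≡ y ⊎ (L y , Tm y) <ₗₑₓ (L x , Tm x)
    walk-descends nil = inj₁ refl
    walk-descends (cons a la refl w) with walk-descends w
    ... | inj₁ refl = inj₂ (lowArc-descends la)
    ... | inj₂ lt = inj₂ (<ₗₑₓ-trans lt (lowArc-descends la))

    acyclic : ¬ HasCycle (LowArcs s)
    acyclic (_ , a , la , refl , w) with walk-descends w
    ... | inj₁ t≡s = <ₗₑₓ-irrefl (subst (λ z → (L z , Tm z) <ₗₑₓ (L (src a) , Tm (src a))) t≡s (lowArc-descends la))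
    ... | inj₂ lt = <ₗₑₓ-irrefl (<ₗₑₓ-trans lt (lowArc-descends la))

    not-from-leader : ∀ v → Leader s v → ∀ a → LowArcs s a → src a ≢ v
    not-from-leader v lv a (u , fu , ua) sa with trans (sym (Core.lowArc-src c u a ua)) sa
    ... | refl = fu lv

    unique-from : ∀ {v a} → lowArc s v ≡ just a → ∀ b → LowArcs s b → src b ≡ v → b ≡ a
    unique-from va b (u , _ , ub) sb with trans (sym (Core.lowArc-src c u b ub)) sb
    ... | refl = just-injective (trans (sym ub) va)

  lowArcs-forest : ∀ {s L Tm clk} → Core s [] L Tm clk → (∀ v → pre s v ≢ 0) →
                   IsInForest (LowArcs s) (Leader s)
  lowArcs-forest {s} c visited = follower-arc , LowArcs.not-from-leader c , LowArcs.acyclic c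
    where
      follower-arc : ∀ v → Follower s v →
                     Σ (Fin m) λ a → LowArcs s a × src a ≡ v × (∀ b → LowArcs s b → src b ≡ v → b ≡ a)
      follower-arc v fv with lowArc s v in va
      ... | nothing = ⊥-elim (fv (proj₂ (Core.lowArc-none-leader c v va (visited v) λ ())))
      ... | just a = a , (v , fv , va) , Core.lowArc-src c v a va , LowArcs.unique-from c va


corollary1 : ∀ {n m : ℕ} (G : Digraph n m) (s : Run.State G) →
    Run.Reachable G s → Run.Final G s →
    Run.IsInForest G (Run.LowArcs G s) (Run.Leader G s)
corollary1 G s run (no-current , visited , _) with Forest.final-core G run no-current
... | _ , _ , _ , c = Forest.lowArcs-forest G c visited
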